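{- Let $\phi$ be a Drinfeld module over $A=\mathbb{F}_q[\theta]$, let $a\in A$, and let $Q\in A$ be an irreducible polynomial not dividing $a$. Then $\mathscr{P}_{\phi,Q,a}$ is irreducible if and only if $Q$ divides $\phi_P(a)$ for some monic irreducible polynomial $P$.
   Context: Let $q$ be a power of a prime $p$, $A=\mathbb{F}_q[\theta]$. Let $A\{\tau\}$ be the ring of twisted polynomials $\sum_i b_i\tau^i$ ($b_i\in A$) with $\tau b=b^q\tau$. A Drinfeld module of rank $r\geq1$ is an $\mathbb{F}_q$-algebra homomorphism $\phi:A\to A\{\tau\}$, $b\mapsto\phi_b$, with $\phi_\theta=\theta+\sum_{i=1}^r a_i\tau^i$, $a_i\in A$, $a_r\neq0$; for $\phi_b=\sum_i c_i\tau^i$ and $x\in A$, $\phi_b(x)=\sum_i c_ix^{q^i}$. For nonzero $m\in A$, $\pi_a(\phi,m)=\{b\in A:\phi_b(a)\in mA\}$, a nonzero ideal of $A$; $\mathscr{P}_{\phi,Q,a}$ denotes its monic generator for $m=Q$, so that for $b\in A$, $\phi_b(a)\equiv0\pmod Q$ iff $\mathscr{P}_{\phi,Q,a}\mid b$. -}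

module Defs where

open import Data.Nat using (ℕ; zero; suc)
open import Data.List using (List; []; _∷_; length; reverse; dropWhile; map)
open import Data.List.Membership.Propositional using (_∈_)
open import Data.List.Relation.Unary.Unique.Propositional using (Unique)
open import Data.Maybe using (Maybe; just; nothing)
open import Data.Vec using (Vec; toList)
open import Data.Product using (Σ; _×_; ∃; ∃-syntax; _,_)
open import Data.Sum using (_⊎_)
open import Relation.Nullary using (¬_; Dec)
open import Relation.Binary.PropositionalEquality using (_≡_)
open import Algebra.Structures using (IsCommutativeRing)

record FiniteField : Set₁ where
  field
    Carrier : Set
    _+_ _*_ : Carrier → Carrier → Carrier
    -_      : Carrier → Carrier
    0# 1#   : Carrier
    isCommutativeRing : IsCommutativeRing _≡_ _+_ _*_ -_ 0# 1#
    0≢1     : ¬ (0# ≡ 1#)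
    inverse : ∀ x → ¬ (x ≡ 0#) → ∃[ y ] (x * y ≡ 1#)
    _≟_     : (x y : Carrier) → Dec (x ≡ y)
    elements : List Carrier
    complete : ∀ x → x ∈ elements
    unique   : Unique elements

  q : ℕ
  q = length elements

module DrinfeldDefs (F : FiniteField) where
  open FiniteField F renaming (_+_ to _+F_; _*_ to _*F_; -_ to -F_)

  -- A = F_q[θ]: coefficient lists, lowest degree first.
  A : Set
  A = List Carrier

  coeff : A → ℕ → Carrier
  coeff []       _       = 0#
  coeff (c ∷ _)  zero    = c
  coeff (_ ∷ cs) (suc n) = coeff cs n

  -- equality of polynomials (ignoring trailing zeros)
  _≈_ : A → A → Set
  f ≈ g = ∀ n → coeff f n ≡ coeff g n

  _+_ : A → A → A
  []       + g        = g
  (c ∷ cs) + []       = c ∷ cs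
  (c ∷ cs) + (d ∷ ds) = (c +F d) ∷ (cs + ds)

  scale : Carrier → A → A
  scale c = map (c *F_)

  _*_ : A → A → A
  []       * g = []
  (c ∷ cs) * g = scale c g + (0# ∷ (cs * g))

  0A 1A θ : A
  0A = []
  1A = 1# ∷ []
  θ  = 0# ∷ 1# ∷ []

  _^_ : A → ℕ → A
  f ^ zero  = 1A
  f ^ suc n = f * (f ^ n)

  lead : A → Maybe Carrier
  lead f with dropWhile (λ c → c ≟ 0#) (reverse f)
  ... | []    = nothing
  ... | l ∷ _ = just l

  Monic : A → Set
  Monic f = lead f ≡ just 1#

  _∣_ : A → A → Set
  d ∣ b = ∃[ c ] ((c * d) ≈ b)

  IsUnit : A → Set
  IsUnit f = ∃[ c ] (¬ (c ≡ 0#) × (f ≈ (c ∷ [])))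

  Irreducible : A → Set
  Irreducible f = ¬ (f ≈ 0A) × ¬ IsUnit f
                × (∀ g h → (g * h) ≈ f → IsUnit g ⊎ IsUnit h)

  -- Twisted polynomials A{τ}: Σ_i b_i τ^i as coefficient lists, with τ b = b^q τ.
  Aτ : Set
  Aτ = List A

  _+τ_ : Aτ → Aτ → Aτ
  []       +τ g        = g
  (c ∷ cs) +τ []       = c ∷ cs
  (c ∷ cs) +τ (d ∷ ds) = (c + d) ∷ (cs +τ ds)

  frob : Aτ → Aτ
  frob = map (_^ q)

  -- (c + R τ) · D = c·D + (R · frob D) τ
  _*τ_ : Aτ → Aτ → Aτ
  []       *τ d = []
  (c ∷ cs) *τ d = map (c *_) d +τ (0A ∷ (cs *τ frob d))

  evalτ : Aτ → A → A
  evalτ []       x = 0A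
  evalτ (c ∷ cs) x = (c * x) + evalτ cs (x ^ q)

  -- A Drinfeld module of rank r ≥ 1: φ_θ = θ + a_1 τ + … + a_r τ^r, a_r ≠ 0.
  record DrinfeldModule : Set where
    field
      rank-1 : ℕ                       -- r = suc rank-1 ≥ 1
      coeffs : Vec A (suc rank-1)
      leadNZ : ¬ (Data.Vec.last coeffs ≈ 0A)

    φθ : Aτ
    φθ = θ ∷ toList coeffs

    -- the F_q-algebra homomorphism b ↦ φ_b determined by φ_θ
    -- (Horner: φ_{c + θ b'} = c + φ_θ φ_{b'})
    φ : A → Aτ
    φ []       = []
    φ (c ∷ cs) = ((c ∷ []) ∷ []) +τ (φθ *τ φ cs)

    act : A → A → A
    act b x = evalτ (φ b) x

  open DrinfeldModule public

  -- 𝒫 is the monic generator of π_a(φ,Q) = {b : φ_b(a) ≡ 0 mod Q}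
  IsMonicGenerator : DrinfeldModule → A → A → A → Set
  IsMonicGenerator ϕ Q a 𝒫 =
    Monic 𝒫 × (∀ b → ((Q ∣ act ϕ b a) → (𝒫 ∣ b)) × ((𝒫 ∣ b) → (Q ∣ act ϕ b a)))

{-# OPTIONS --safe #-}
-- A polynomial b lies in π_a(φ,Q) exactly when 𝒫 divides it, so 𝒫 itself annihilates a
-- modulo Q. Conversely, if Q ∣ φ_P(a) with P irreducible then 𝒫 ∣ P, and 𝒫 is not a unit,
-- since otherwise Q would divide φ_1(a) = a. A non-unit divisor of an irreducible polynomial
-- is a nonzero constant multiple of it, hence irreducible.
module Submission where

open import Defs
open import Data.Nat using (zero; suc)
open import Data.List using ([]; _∷_)
open import Data.Product using (_×_; ∃-syntax; _,_; proj₁; proj₂)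
open import Data.Sum using (_⊎_; inj₁; inj₂)
open import Data.Vec using (toList)
open import Function using (_∘_)
open import Relation.Nullary using (¬_; contradiction)
open import Relation.Binary.Bundles using (Setoid)
import Relation.Binary.Reasoning.Setoid as SetoidReasoning
open import Relation.Binary.PropositionalEquality
  using (_≡_; _≢_; refl; sym; trans; cong; cong₂; module ≡-Reasoning)
open import Algebra.Structures using (IsCommutativeRing)

module Coefficients (F : FiniteField) where
  open FiniteField F renaming (_+_ to _+F_; _*_ to _*F_)
  open DrinfeldDefs F
  open IsCommutativeRing isCommutativeRing
    using (+-identityˡ; +-identityʳ; *-identityˡ; zeroˡ; zeroʳ; *-assoc; *-comm; distribˡ)
  open ≡-Reasoning

  *-≢0 : ∀ {x y} → x ≢ 0# → y ≢ 0# → x *F y ≢ 0#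
  *-≢0 {x} {y} x≢0 y≢0 xy≡0 with inverse x x≢0
  ... | x⁻¹ , xx⁻¹≡1 = y≢0 (begin
    y                  ≡⟨ sym (*-identityˡ y) ⟩
    1# *F y            ≡⟨ cong (_*F y) (trans (sym xx⁻¹≡1) (*-comm x x⁻¹)) ⟩
    (x⁻¹ *F x) *F y    ≡⟨ *-assoc x⁻¹ x y ⟩
    x⁻¹ *F (x *F y)    ≡⟨ cong (x⁻¹ *F_) xy≡0 ⟩
    x⁻¹ *F 0#          ≡⟨ zeroʳ x⁻¹ ⟩
    0#                 ∎)

  inverse-≢0 : ∀ {x y} → x *F y ≡ 1# → y ≢ 0#
  inverse-≢0 {x} xy≡1 y≡0 = 0≢1 (trans (sym (zeroʳ x)) (trans (cong (x *F_) (sym y≡0)) xy≡1))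

  ≈-setoid : Setoid _ _
  ≈-setoid = record
    { Carrier       = A
    ; _≈_           = _≈_
    ; isEquivalence = record
      { refl  = λ _ → refl
      ; sym   = λ f≈g → sym ∘ f≈g
      ; trans = λ f≈g g≈h n → trans (f≈g n) (g≈h n)
      }
    }

  coeff-+ : ∀ f g n → coeff (f + g) n ≡ coeff f n +F coeff g n
  coeff-+ []       g        n       = sym (+-identityˡ _)
  coeff-+ (c ∷ cs) []       n       = sym (+-identityʳ _)
  coeff-+ (c ∷ cs) (d ∷ ds) zero    = refl
  coeff-+ (c ∷ cs) (d ∷ ds) (suc n) = coeff-+ cs ds n

  +-identityʳ-≡ : ∀ f → f + 0A ≡ f
  +-identityʳ-≡ []      = refl
  +-identityʳ-≡ (_ ∷ _) = refl

  coeff-scale : ∀ k f n → coeff (scale k f) n ≡ k *F coeff f n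
  coeff-scale k []       n       = sym (zeroʳ k)
  coeff-scale k (c ∷ cs) zero    = refl
  coeff-scale k (c ∷ cs) (suc n) = coeff-scale k cs n

  coeff-∷-* : ∀ c cs g n → coeff ((c ∷ cs) * g) n ≡ (c *F coeff g n) +F coeff (0# ∷ (cs * g)) n
  coeff-∷-* c cs g n =
    trans (coeff-+ (scale c g) _ n) (cong (_+F coeff (0# ∷ (cs * g)) n) (coeff-scale c g n))

  scale-resp-≈ : ∀ k f g → f ≈ g → scale k f ≈ scale k g
  scale-resp-≈ k f g f≈g n =
    trans (coeff-scale k f n) (trans (cong (k *F_) (f≈g n)) (sym (coeff-scale k g n)))

  scale-inverse : ∀ {x y} → x *F y ≡ 1# → ∀ f → scale y (scale x f) ≈ f
  scale-inverse {x} {y} xy≡1 f n = begin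
    coeff (scale y (scale x f)) n  ≡⟨ coeff-scale y (scale x f) n ⟩
    y *F coeff (scale x f) n       ≡⟨ cong (y *F_) (coeff-scale x f n) ⟩
    y *F (x *F coeff f n)          ≡⟨ sym (*-assoc y x _) ⟩
    (y *F x) *F coeff f n          ≡⟨ cong (_*F coeff f n) (trans (*-comm y x) xy≡1) ⟩
    1# *F coeff f n                ≡⟨ *-identityˡ _ ⟩
    coeff f n                      ∎

  0#∷-≈0 : ∀ cs → cs ≈ 0A → (0# ∷ cs) ≈ 0A
  0#∷-≈0 cs cs≈0 zero    = refl
  0#∷-≈0 cs cs≈0 (suc n) = cs≈0 n

  *-zeroˡ-≈ : ∀ f g → f ≈ 0A → (f * g) ≈ 0A
  *-zeroˡ-≈ []       g f≈0 n = refl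
  *-zeroˡ-≈ (c ∷ cs) g f≈0 n = begin
    coeff ((c ∷ cs) * g) n                       ≡⟨ coeff-∷-* c cs g n ⟩
    (c *F coeff g n) +F coeff (0# ∷ (cs * g)) n  ≡⟨ cong₂ _+F_ c*g≡0 (shifted≈0 n) ⟩
    0# +F 0#                                     ≡⟨ +-identityˡ 0# ⟩
    0#                                           ∎
    where
    c*g≡0 : c *F coeff g n ≡ 0#
    c*g≡0 = trans (cong (_*F coeff g n) (f≈0 zero)) (zeroˡ _)

    shifted≈0 : (0# ∷ (cs * g)) ≈ 0A
    shifted≈0 = 0#∷-≈0 (cs * g) (*-zeroˡ-≈ cs g (f≈0 ∘ suc))

  *-constˡ : ∀ {k} c g → c ≈ (k ∷ []) → (c * g) ≈ scale k g
  *-constˡ {k} [] g c≈k n = begin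
    0#                   ≡⟨ sym (zeroˡ _) ⟩
    0# *F coeff g n      ≡⟨ cong (_*F coeff g n) (c≈k zero) ⟩
    k *F coeff g n       ≡⟨ sym (coeff-scale k g n) ⟩
    coeff (scale k g) n  ∎
  *-constˡ {k} (c ∷ cs) g c≈k n = begin
    coeff ((c ∷ cs) * g) n                       ≡⟨ coeff-∷-* c cs g n ⟩
    (c *F coeff g n) +F coeff (0# ∷ (cs * g)) n  ≡⟨ cong₂ _+F_ (cong (_*F coeff g n) (c≈k zero)) (shifted≈0 n) ⟩
    (k *F coeff g n) +F 0#                       ≡⟨ +-identityʳ _ ⟩
    k *F coeff g n                               ≡⟨ sym (coeff-scale k g n) ⟩
    coeff (scale k g) n                          ∎
    where
    shifted≈0 : (0# ∷ (cs * g)) ≈ 0A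
    shifted≈0 = 0#∷-≈0 (cs * g) (*-zeroˡ-≈ cs g (c≈k ∘ suc))

  scale-*ˡ : ∀ k g h → (scale k g * h) ≈ scale k (g * h)
  scale-*ˡ k []       h n = refl
  scale-*ˡ k (d ∷ ds) h n = begin
    coeff (scale k (d ∷ ds) * h) n
      ≡⟨ coeff-∷-* (k *F d) (scale k ds) h n ⟩
    ((k *F d) *F coeff h n) +F coeff (0# ∷ (scale k ds * h)) n
      ≡⟨ cong₂ _+F_ (*-assoc k d _) (shifted n) ⟩
    (k *F (d *F coeff h n)) +F (k *F coeff (0# ∷ (ds * h)) n)
      ≡⟨ sym (distribˡ k _ _) ⟩
    k *F ((d *F coeff h n) +F coeff (0# ∷ (ds * h)) n)
      ≡⟨ cong (k *F_) (sym (coeff-∷-* d ds h n)) ⟩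
    k *F coeff ((d ∷ ds) * h) n
      ≡⟨ sym (coeff-scale k ((d ∷ ds) * h) n) ⟩
    coeff (scale k ((d ∷ ds) * h)) n
      ∎
    where
    shifted : ∀ n → coeff (0# ∷ (scale k ds * h)) n ≡ k *F coeff (0# ∷ (ds * h)) n
    shifted zero    = sym (zeroʳ k)
    shifted (suc n) = trans (scale-*ˡ k ds h n) (coeff-scale k (ds * h) n)

  *-identityˡ-≈ : ∀ f → (1A * f) ≈ f
  *-identityˡ-≈ f n =
    trans (*-constˡ 1A f (λ _ → refl) n) (trans (coeff-scale 1# f n) (*-identityˡ _))

module Divisibility (F : FiniteField) where
  open FiniteField F using (0#; inverse; isCommutativeRing) renaming (_*_ to _*F_)
  open DrinfeldDefs F
  open IsCommutativeRing isCommutativeRing using (*-comm)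
  open Coefficients F
  open SetoidReasoning ≈-setoid

  ∣-refl : ∀ f → f ∣ f
  ∣-refl f = 1A , *-identityˡ-≈ f

  ∣-respʳ-≈ : ∀ d f g → f ≈ g → d ∣ f → d ∣ g
  ∣-respʳ-≈ d f g f≈g (c , cd≈f) = c , λ n → trans (cd≈f n) (f≈g n)

  IsUnit-resp-≈ : ∀ f g → f ≈ g → IsUnit f → IsUnit g
  IsUnit-resp-≈ f g f≈g (c , c≢0 , f≈c) = c , c≢0 , λ n → trans (sym (f≈g n)) (f≈c n)

  IsUnit-scale : ∀ {k} f → k ≢ 0# → IsUnit f → IsUnit (scale k f)
  IsUnit-scale {k} f k≢0 (c , c≢0 , f≈c) = k *F c , *-≢0 k≢0 c≢0 , scale-resp-≈ k f (c ∷ []) f≈c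

  IsUnit⇒∣1A : ∀ f → IsUnit f → f ∣ 1A
  IsUnit⇒∣1A f (c , c≢0 , f≈c) with inverse c c≢0
  ... | c⁻¹ , cc⁻¹≡1 = c⁻¹ ∷ [] , (begin
    (c⁻¹ ∷ []) * f          ≈⟨ *-constˡ (c⁻¹ ∷ []) f (λ _ → refl) ⟩
    scale c⁻¹ f             ≈⟨ scale-resp-≈ c⁻¹ f (c ∷ []) f≈c ⟩
    (c⁻¹ *F c) ∷ []         ≈⟨ c⁻¹c≈1 ⟩
    1A                      ∎)
    where
    c⁻¹c≈1 : ((c⁻¹ *F c) ∷ []) ≈ 1A
    c⁻¹c≈1 zero    = trans (*-comm c⁻¹ c) cc⁻¹≡1
    c⁻¹c≈1 (suc n) = refl

  Irreducible-resp-≈ : ∀ f g → f ≈ g → Irreducible f → Irreducible g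
  Irreducible-resp-≈ f g f≈g (f≉0 , f-nonUnit , f-factors) =
      (λ g≈0 → f≉0 λ n → trans (f≈g n) (g≈0 n))
    , (λ g-unit → f-nonUnit (IsUnit-resp-≈ g f (sym ∘ f≈g) g-unit))
    , (λ u v uv≈g → f-factors u v λ n → trans (uv≈g n) (sym (f≈g n)))

  Irreducible-scale : ∀ {k} f → k ≢ 0# → Irreducible f → Irreducible (scale k f)
  Irreducible-scale {k} f k≢0 (f≉0 , f-nonUnit , f-factors) with inverse k k≢0
  ... | k⁻¹ , kk⁻¹≡1 = kf≉0 , kf-nonUnit , kf-factors
    where
    kf≉0 : ¬ (scale k f ≈ 0A)
    kf≉0 kf≈0 = f≉0 (begin
      f                      ≈⟨ scale-inverse kk⁻¹≡1 f ⟨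
      scale k⁻¹ (scale k f)  ≈⟨ scale-resp-≈ k⁻¹ (scale k f) 0A kf≈0 ⟩
      0A                     ∎)

    kf-nonUnit : ¬ IsUnit (scale k f)
    kf-nonUnit = f-nonUnit
               ∘ IsUnit-resp-≈ (scale k⁻¹ (scale k f)) f (scale-inverse kk⁻¹≡1 f)
               ∘ IsUnit-scale (scale k f) (inverse-≢0 kk⁻¹≡1)

    kf-factors : ∀ u v → (u * v) ≈ scale k f → IsUnit u ⊎ IsUnit v
    kf-factors u v uv≈kf with f-factors (scale k⁻¹ u) v (begin
      scale k⁻¹ u * v        ≈⟨ scale-*ˡ k⁻¹ u v ⟩
      scale k⁻¹ (u * v)      ≈⟨ scale-resp-≈ k⁻¹ (u * v) (scale k f) uv≈kf ⟩
      scale k⁻¹ (scale k f)  ≈⟨ scale-inverse kk⁻¹≡1 f ⟩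
      f                      ∎)
    ... | inj₁ k⁻¹u-unit = inj₁ (IsUnit-resp-≈ (scale k (scale k⁻¹ u)) u
                                  (scale-inverse (trans (*-comm k⁻¹ k) kk⁻¹≡1) u)
                                  (IsUnit-scale (scale k⁻¹ u) k≢0 k⁻¹u-unit))
    ... | inj₂ v-unit    = inj₂ v-unit

  Irreducible-scale⁻¹ : ∀ {k} f → k ≢ 0# → Irreducible (scale k f) → Irreducible f
  Irreducible-scale⁻¹ {k} f k≢0 kf-irreducible with inverse k k≢0
  ... | k⁻¹ , kk⁻¹≡1 = Irreducible-resp-≈ (scale k⁻¹ (scale k f)) f (scale-inverse kk⁻¹≡1 f)
                         (Irreducible-scale (scale k f) (inverse-≢0 kk⁻¹≡1) kf-irreducible)

  nonUnit∣Irreducible⇒Irreducible : ∀ f P → Irreducible P → f ∣ P → ¬ IsUnit f → Irreducible f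
  nonUnit∣Irreducible⇒Irreducible f P P-irreducible@(_ , _ , P-factors) (c , cf≈P) f-nonUnit
    with P-factors c f cf≈P
  ... | inj₂ f-unit           = contradiction f-unit f-nonUnit
  ... | inj₁ (k , k≢0 , c≈k) =
    Irreducible-scale⁻¹ f k≢0 (Irreducible-resp-≈ P (scale k f) P≈kf P-irreducible)
    where
    P≈kf : P ≈ scale k f
    P≈kf = begin
      P          ≈⟨ cf≈P ⟨
      c * f      ≈⟨ *-constˡ c f c≈k ⟩
      scale k f  ∎

module MonicGenerators (F : FiniteField) where
  open FiniteField F using (q)
  open DrinfeldDefs F
  open Coefficients F
  open Divisibility F
  open SetoidReasoning ≈-setoid

  evalτ-*τ-0A : ∀ L x → evalτ (L *τ []) x ≡ 0A
  evalτ-*τ-0A []      x = refl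
  evalτ-*τ-0A (_ ∷ L) x = evalτ-*τ-0A L (x ^ q)

  act-1A : ∀ ϕ x → act ϕ 1A x ≈ x
  act-1A ϕ x = begin
    act ϕ 1A x                               ≡⟨⟩
    (1A * x) + evalτ (a₁…aᵣ *τ []) (x ^ q)  ≡⟨ cong ((1A * x) +_) (evalτ-*τ-0A a₁…aᵣ (x ^ q)) ⟩
    (1A * x) + 0A                            ≡⟨ +-identityʳ-≡ (1A * x) ⟩
    1A * x                                   ≈⟨ *-identityˡ-≈ x ⟩
    x                                        ∎
    where
    a₁…aᵣ : Aτ
    a₁…aᵣ = toList (coeffs ϕ)

  monicGenerator-nonUnit : ∀ ϕ Q a 𝒫 → ¬ (Q ∣ a) → IsMonicGenerator ϕ Q a 𝒫 → ¬ IsUnit 𝒫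
  monicGenerator-nonUnit ϕ Q a 𝒫 Q∤a (_ , 𝒫-generates) 𝒫-unit =
    Q∤a (∣-respʳ-≈ Q (act ϕ 1A a) a (act-1A ϕ a) (proj₂ (𝒫-generates 1A) (IsUnit⇒∣1A 𝒫 𝒫-unit)))

mainTheorem12 : (F : FiniteField) → let open DrinfeldDefs F in
    (ϕ : DrinfeldModule) (a Q : A) → Irreducible Q → ¬ (Q ∣ a) →
    (𝒫 : A) → IsMonicGenerator ϕ Q a 𝒫 →
    (Irreducible 𝒫 → ∃[ P ] (Monic P × Irreducible P × (Q ∣ act ϕ P a)))
    × ((∃[ P ] (Monic P × Irreducible P × (Q ∣ act ϕ P a))) → Irreducible 𝒫)
mainTheorem12 F ϕ a Q _ Q∤a 𝒫 𝒫-isGenerator@(𝒫-monic , 𝒫-generates) =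
    (λ 𝒫-irreducible → 𝒫 , 𝒫-monic , 𝒫-irreducible , proj₂ (𝒫-generates 𝒫) (∣-refl 𝒫))
  , λ { (P , _ , P-irreducible , Q∣ϕPa) →
          nonUnit∣Irreducible⇒Irreducible 𝒫 P P-irreducible (proj₁ (𝒫-generates P) Q∣ϕPa)
            (monicGenerator-nonUnit ϕ Q a 𝒫 Q∤a 𝒫-isGenerator) }
  where
  open Divisibility F
  open MonicGenerators F
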